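{- Let $A_m\in\mathbf{U}_m$ and let $\alpha,\beta\subset I_m$ be saturated index sets for $A_m$. Then (i) if $\alpha\cap\beta\neq\emptyset$, then $\alpha\cap\beta$ is a saturated index set for $A_m$; (ii) $\alpha\cup\beta$ is a saturated index set for $A_m$.
   Context: $I_m=\{1,\dots,m\}$. $\mathbf{U}_m$ is the set of real $m\times m$ matrices $A_m=(a_{ij})$ with $a_{ij}=a_{ji}\ge 0$ for all $i,j$ and $\sum_{i,j\in\alpha}a_{ij}\le|\alpha|$ for every $\alpha\subset I_m$ ($|\alpha|$ the cardinality). For $A_m\in\mathbf{U}_m$, an index set $\alpha\subset I_m$ is called saturated if $\sum_{i,j\in\alpha}a_{ij}=|\alpha|$. -}

module Defs where

open import Level using (Level; _⊔_)
open import Data.Nat as ℕ using (ℕ)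
open import Data.Fin using (Fin; zero; suc)
open import Data.Vec using ([]; _∷_)
open import Data.Bool using (true; false)
open import Data.Fin.Subset using (Subset; ∣_∣)
open import Relation.Binary.Core using (Rel)
open import Relation.Binary.Structures using (IsTotalOrder)
open import Relation.Nullary using (¬_)
open import Algebra.Bundles using (CommutativeRing)
open import Data.Product using (Σ; _×_)

-- An ordered field (the paper works over ℝ, which is one; stdlib has no reals).
record OrderedField (c ℓ₁ ℓ₂ : Level) : Set (Level.suc (c ⊔ ℓ₁ ⊔ ℓ₂)) where
  field
    commutativeRing : CommutativeRing c ℓ₁
  open CommutativeRing commutativeRing public
  field
    _≤_          : Rel Carrier ℓ₂
    isTotalOrder : IsTotalOrder _≈_ _≤_
    +-mono-≤     : ∀ {x y} z → x ≤ y → (x + z) ≤ (y + z)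
    *-nonneg     : ∀ {x y} → 0# ≤ x → 0# ≤ y → 0# ≤ (x * y)
    0≉1          : ¬ (0# ≈ 1#)
    inverse      : ∀ x → ¬ (x ≈ 0#) → Σ Carrier (λ y → (x * y) ≈ 1#)

module _ {c ℓ₁ ℓ₂} (F : OrderedField c ℓ₁ ℓ₂) where
  open OrderedField F using (Carrier; _≈_; _≤_; _+_; 0#; 1#)

  natF : ℕ → Carrier
  natF ℕ.zero    = 0#
  natF (ℕ.suc n) = 1# + natF n

  sumOver : ∀ {m} → Subset m → (Fin m → Carrier) → Carrier
  sumOver []           f = 0#
  sumOver (true  ∷ α)  f = f zero + sumOver α (λ i → f (suc i))
  sumOver (false ∷ α)  f = sumOver α (λ i → f (suc i))

  blockSum : ∀ {m} → (Fin m → Fin m → Carrier) → Subset m → Carrier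
  blockSum a α = sumOver α (λ i → sumOver α (λ j → a i j))

  InU : ∀ m → (Fin m → Fin m → Carrier) → Set (ℓ₁ ⊔ ℓ₂)
  InU m a = (∀ i j → a i j ≈ a j i) × (∀ i j → 0# ≤ a i j)
          × (∀ (α : Subset m) → blockSum a α ≤ natF ∣ α ∣)

  Saturated : ∀ {m} → (Fin m → Fin m → Carrier) → Subset m → Set ℓ₁
  Saturated a α = blockSum a α ≈ natF ∣ α ∣

module Submission where

open import Defs
open import Data.Nat using (ℕ)
open import Data.Fin using (Fin)
open import Data.Fin.Subset using (Subset; _∩_; _∪_; Nonempty)
open import Data.Product using (_×_)

import Data.Nat as ℕ
import Data.Nat.Properties as ℕ
open import Data.Fin using (zero; suc)
open import Data.Vec using ([]; _∷_)
open import Data.Bool using (true; false)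
open import Data.Fin.Subset using (∣_∣)
open import Data.Fin.Subset.Properties using (∪-comm)
open import Data.Product using (_,_)
open import Relation.Binary.Bundles using (Poset)
open import Relation.Binary.Structures using (IsTotalOrder)
open import Relation.Binary.PropositionalEquality as ≡ using (_≡_)
import Algebra.Properties.CommutativeSemigroup as CommutativeSemigroupProperties
import Algebra.Properties.Group as GroupProperties
import Relation.Binary.Reasoning.PartialOrder as PosetReasoning

-- The block sum γ ↦ Σ_{i,j∈γ} a_ij of a nonnegative matrix is supermodular,
-- since every term counted in blockSum α + blockSum β is counted at least as often in
-- blockSum (α ∪ β) + blockSum (α ∩ β), while γ ↦ |γ| is modular. Hence
--   |α ∪ β| + |α ∩ β| = blockSum α + blockSum β ≤ blockSum (α ∪ β) + blockSum (α ∩ β),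
-- and the bounds blockSum γ ≤ |γ| for γ = α ∪ β, α ∩ β force equality in both.

∣p∪q∣+∣p∩q∣≡∣p∣+∣q∣ : ∀ {m} (p q : Subset m) → ∣ p ∪ q ∣ ℕ.+ ∣ p ∩ q ∣ ≡ ∣ p ∣ ℕ.+ ∣ q ∣
∣p∪q∣+∣p∩q∣≡∣p∣+∣q∣ []          []          = ≡.refl
∣p∪q∣+∣p∩q∣≡∣p∣+∣q∣ (true  ∷ p) (true  ∷ q) = ≡.cong ℕ.suc (begin
  ∣ p ∪ q ∣ ℕ.+ ℕ.suc ∣ p ∩ q ∣ ≡⟨ ℕ.+-suc ∣ p ∪ q ∣ ∣ p ∩ q ∣ ⟩
  ℕ.suc (∣ p ∪ q ∣ ℕ.+ ∣ p ∩ q ∣) ≡⟨ ≡.cong ℕ.suc (∣p∪q∣+∣p∩q∣≡∣p∣+∣q∣ p q) ⟩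
  ℕ.suc (∣ p ∣ ℕ.+ ∣ q ∣)         ≡⟨ ℕ.+-suc ∣ p ∣ ∣ q ∣ ⟨
  ∣ p ∣ ℕ.+ ℕ.suc ∣ q ∣           ∎)
  where open ≡.≡-Reasoning
∣p∪q∣+∣p∩q∣≡∣p∣+∣q∣ (true  ∷ p) (false ∷ q) = ≡.cong ℕ.suc (∣p∪q∣+∣p∩q∣≡∣p∣+∣q∣ p q)
∣p∪q∣+∣p∩q∣≡∣p∣+∣q∣ (false ∷ p) (true  ∷ q) =
  ≡.trans (≡.cong ℕ.suc (∣p∪q∣+∣p∩q∣≡∣p∣+∣q∣ p q)) (≡.sym (ℕ.+-suc ∣ p ∣ ∣ q ∣))
∣p∪q∣+∣p∩q∣≡∣p∣+∣q∣ (false ∷ p) (false ∷ q) = ∣p∪q∣+∣p∩q∣≡∣p∣+∣q∣ p q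

module _ {c ℓ₁ ℓ₂} (F : OrderedField c ℓ₁ ℓ₂) where
  open OrderedField F hiding (zero) renaming (_≤_ to infix 4 _≤_)
  open IsTotalOrder isTotalOrder using (isPartialOrder; antisym)
    renaming (refl to ≤-refl; trans to ≤-trans)
  open CommutativeSemigroupProperties +-commutativeSemigroup using (interchange; x∙yz≈y∙xz)
  open GroupProperties +-group using (∙-cancelˡ; ∙-cancelʳ)

  poset : Poset c ℓ₁ ℓ₂
  poset = record { isPartialOrder = isPartialOrder }

  open PosetReasoning poset

  +-monoʳ-≤ : ∀ z {x y} → x ≤ y → z + x ≤ z + y
  +-monoʳ-≤ z {x} {y} x≤y = begin
    z + x ≈⟨ +-comm z x ⟩
    x + z ≤⟨ +-mono-≤ z x≤y ⟩
    y + z ≈⟨ +-comm y z ⟩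
    z + y ∎

  +-mono₂-≤ : ∀ {x y u v} → x ≤ y → u ≤ v → x + u ≤ y + v
  +-mono₂-≤ {y = y} {u} x≤y u≤v = ≤-trans (+-mono-≤ u x≤y) (+-monoʳ-≤ y u≤v)

  +-tight : ∀ {x x′ y y′} → x ≤ x′ → y ≤ y′ → x′ + y′ ≤ x + y → x ≈ x′ × y ≈ y′
  +-tight {x} {x′} {y} {y′} x≤x′ y≤y′ x′+y′≤x+y =
    ∙-cancelʳ y x x′ (antisym x+y≤x′+y (≤-trans x′+y≤x′+y′ x′+y′≤x+y)) ,
    ∙-cancelˡ x′ y y′ (antisym x′+y≤x′+y′ (≤-trans x′+y′≤x+y x+y≤x′+y))
    where
    x+y≤x′+y : x + y ≤ x′ + y
    x+y≤x′+y = +-mono-≤ y x≤x′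
    x′+y≤x′+y′ : x′ + y ≤ x′ + y′
    x′+y≤x′+y′ = +-monoʳ-≤ x′ y≤y′

  natF-+ : ∀ a b → natF F (a ℕ.+ b) ≈ natF F a + natF F b
  natF-+ ℕ.zero    b = sym (+-identityˡ (natF F b))
  natF-+ (ℕ.suc a) b = trans (+-cong refl (natF-+ a b)) (sym (+-assoc 1# (natF F a) (natF F b)))

  natF-∣p∪q∣+∣p∩q∣ : ∀ {m} (p q : Subset m) →
    natF F ∣ p ∪ q ∣ + natF F ∣ p ∩ q ∣ ≈ natF F ∣ p ∣ + natF F ∣ q ∣
  natF-∣p∪q∣+∣p∩q∣ p q = trans (sym (natF-+ ∣ p ∪ q ∣ ∣ p ∩ q ∣))
    (trans (reflexive (≡.cong (natF F) (∣p∪q∣+∣p∩q∣≡∣p∣+∣q∣ p q))) (natF-+ ∣ p ∣ ∣ q ∣))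

  sumOver-mono-∪ : ∀ {m} {f : Fin m → Carrier} (p q : Subset m) → (∀ i → 0# ≤ f i) →
    sumOver F p f ≤ sumOver F (p ∪ q) f
  sumOver-mono-∪ []      []      _   = ≤-refl
  sumOver-mono-∪ {f = f} (true  ∷ p) (_ ∷ q) f≥0 =
    +-monoʳ-≤ (f zero) (sumOver-mono-∪ p q (λ i → f≥0 (suc i)))
  sumOver-mono-∪ {f = f} (false ∷ p) (true  ∷ q) f≥0 = begin
    sumOver F p _               ≈⟨ +-identityˡ _ ⟨
    0# + sumOver F p _          ≤⟨ +-mono₂-≤ (f≥0 zero) (sumOver-mono-∪ p q (λ i → f≥0 (suc i))) ⟩
    f zero + sumOver F (p ∪ q) _ ∎
  sumOver-mono-∪ (false ∷ p) (false ∷ q) f≥0 = sumOver-mono-∪ p q (λ i → f≥0 (suc i))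

  -- Indices in both p and q are charged to h + k; indices in only one of them to h alone.
  sumOver-∪-∩ : ∀ {m} {f g h k : Fin m → Carrier} (p q : Subset m) →
    (∀ i → f i ≤ h i) → (∀ i → g i ≤ h i) → (∀ i → f i + g i ≤ h i + k i) →
    sumOver F p f + sumOver F q g ≤ sumOver F (p ∪ q) h + sumOver F (p ∩ q) k
  sumOver-∪-∩ [] [] _ _ _ = ≤-refl
  sumOver-∪-∩ {f = f} {g} {h} {k} (true ∷ p) (true ∷ q) f≤h g≤h f+g≤h+k = begin
    (f zero + _) + (g zero + _) ≈⟨ interchange _ _ _ _ ⟩
    (f zero + g zero) + (_ + _) ≤⟨ +-mono₂-≤ (f+g≤h+k zero) (sumOver-∪-∩ p q
                                      (λ i → f≤h (suc i)) (λ i → g≤h (suc i)) (λ i → f+g≤h+k (suc i))) ⟩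
    (h zero + k zero) + (_ + _) ≈⟨ interchange _ _ _ _ ⟩
    (h zero + _) + (k zero + _) ∎
  sumOver-∪-∩ {f = f} {h = h} (true ∷ p) (false ∷ q) f≤h g≤h f+g≤h+k = begin
    (f zero + _) + _ ≈⟨ +-assoc _ _ _ ⟩
    f zero + (_ + _) ≤⟨ +-mono₂-≤ (f≤h zero) (sumOver-∪-∩ p q
                           (λ i → f≤h (suc i)) (λ i → g≤h (suc i)) (λ i → f+g≤h+k (suc i))) ⟩
    h zero + (_ + _) ≈⟨ +-assoc _ _ _ ⟨
    (h zero + _) + _ ∎
  sumOver-∪-∩ {g = g} {h} (false ∷ p) (true ∷ q) f≤h g≤h f+g≤h+k = begin
    _ + (g zero + _) ≈⟨ x∙yz≈y∙xz _ _ _ ⟩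
    g zero + (_ + _) ≤⟨ +-mono₂-≤ (g≤h zero) (sumOver-∪-∩ p q
                           (λ i → f≤h (suc i)) (λ i → g≤h (suc i)) (λ i → f+g≤h+k (suc i))) ⟩
    h zero + (_ + _) ≈⟨ +-assoc _ _ _ ⟨
    (h zero + _) + _ ∎
  sumOver-∪-∩ (false ∷ p) (false ∷ q) f≤h g≤h f+g≤h+k =
    sumOver-∪-∩ p q (λ i → f≤h (suc i)) (λ i → g≤h (suc i)) (λ i → f+g≤h+k (suc i))

  blockSum-supermodular : ∀ {m} (a : Fin m → Fin m → Carrier) → (∀ i j → 0# ≤ a i j) →
    (p q : Subset m) →
    blockSum F a p + blockSum F a q ≤ blockSum F a (p ∪ q) + blockSum F a (p ∩ q)
  blockSum-supermodular a a≥0 p q = sumOver-∪-∩ p q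
    (λ i → sumOver-mono-∪ p q (a≥0 i))
    (λ i → ≡.subst (λ r → rowSum q i ≤ rowSum r i) (∪-comm q p) (sumOver-mono-∪ q p (a≥0 i)))
    (λ i → sumOver-∪-∩ p q (λ _ → ≤-refl) (λ _ → ≤-refl) (λ _ → ≤-refl))
    where
    rowSum : Subset _ → Fin _ → Carrier
    rowSum r i = sumOver F r (a i)

-- Nonemptiness of α ∩ β is not needed: the empty index set is saturated too.
proposition2p9 : ∀ {c ℓ₁ ℓ₂} (F : OrderedField c ℓ₁ ℓ₂) (m : ℕ)
    (A : Fin m → Fin m → OrderedField.Carrier F) → InU F m A →
    (α β : Subset m) → Saturated F A α → Saturated F A β →
    ((Nonempty (α ∩ β) → Saturated F A (α ∩ β)) × Saturated F A (α ∪ β))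
proposition2p9 F m A (_ , A≥0 , bounded) α β α-sat β-sat =
  let ∪-sat , ∩-sat = +-tight F (bounded (α ∪ β)) (bounded (α ∩ β)) sizes≤blockSums
  in (λ _ → ∩-sat) , ∪-sat
  where
  open OrderedField F using (_+_; +-cong) renaming (_≤_ to infix 4 _≤_)
  open PosetReasoning (poset F)

  sizes≤blockSums : natF F ∣ α ∪ β ∣ + natF F ∣ α ∩ β ∣ ≤ blockSum F A (α ∪ β) + blockSum F A (α ∩ β)
  sizes≤blockSums = begin
    natF F ∣ α ∪ β ∣ + natF F ∣ α ∩ β ∣         ≈⟨ natF-∣p∪q∣+∣p∩q∣ F α β ⟩
    natF F ∣ α ∣ + natF F ∣ β ∣                 ≈⟨ +-cong α-sat β-sat ⟨
    blockSum F A α + blockSum F A β             ≤⟨ blockSum-supermodular F A A≥0 α β ⟩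
    blockSum F A (α ∪ β) + blockSum F A (α ∩ β) ∎
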